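{- Let $\omega\in\mathcal{X}(\mathbb{A})$, and consider a Delaunay triangulation of the plane defined by the set of occupied sites of $\omega$ (viewed as points of $\mathbb{R}^2$). Then every defective triangle of this triangulation has area at most $\frac{3\sqrt3}{2}$.
   Context: $\mathbb{A}$ is the triangular lattice $\{x\mathbf{b}_1+y\mathbf{b}_2:x,y\in\mathbb{Z}\}\subset\mathbb{R}^2$, $\mathbf{b}_1=(1,0)$, $\mathbf{b}_2=(\tfrac12,\tfrac{\sqrt3}2)$ (edge length $1$), two sites adjacent iff at Euclidean distance $1$. $\mathcal{X}(\mathbb{A})$ is the set of $\omega\in\{0,1\}^{\mathbb{A}}$ whose support (set of occupied sites) is a maximal independent set of $\mathbb{A}$. A Delaunay triangulation of a point set $S\subset\mathbb{R}^2$ is a triangulation with vertices in $S$, dual to the Voronoi partition of $S$, such that the circumcircle of each triangle contains no point of $S$ in its interior other than its vertices. A triangle is called regular if it is equilateral with side length $\sqrt7$, and defective otherwise. -}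

module Defs where

open import Data.Bool using (Bool; true; false)
open import Data.Integer as ℤ using (ℤ; +_)
open import Data.Rational as ℚ using (ℚ; _/_)
open import Data.Product using (_×_; _,_; ∃-syntax)
open import Relation.Binary.PropositionalEquality using (_≡_)
open import Relation.Nullary using (¬_)

-- Sites of the triangular lattice 𝔸: the pair (x , y) stands for the
-- point x·b₁ + y·b₂ of ℝ², with b₁ = (1,0), b₂ = (1/2, √3/2).
Site : Set
Site = ℤ × ℤ

-- Points of the plane with rational coordinates in the basis (b₁ , b₂).
PointQ : Set
PointQ = ℚ × ℚ

-- Squared Euclidean norm of x·b₁ + y·b₂ :  |x b₁ + y b₂|² = x² + xy + y².
normSqℤ : ℤ → ℤ → ℤ
normSqℤ x y = x ℤ.* x ℤ.+ x ℤ.* y ℤ.+ y ℤ.* y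

normSqℚ : ℚ → ℚ → ℚ
normSqℚ x y = x ℚ.* x ℚ.+ x ℚ.* y ℚ.+ y ℚ.* y

distSq : Site → Site → ℤ
distSq (x₁ , y₁) (x₂ , y₂) = normSqℤ (x₁ ℤ.- x₂) (y₁ ℤ.- y₂)

toQ : Site → PointQ
toQ (x , y) = (x / 1 , y / 1)

distSqℚ : PointQ → PointQ → ℚ
distSqℚ (x₁ , y₁) (x₂ , y₂) = normSqℚ (x₁ ℚ.- x₂) (y₁ ℚ.- y₂)

Adjacent : Site → Site → Set
Adjacent u v = distSq u v ≡ + 1

Config : Set
Config = Site → Bool

Occupied : Config → Site → Set
Occupied ω u = ω u ≡ true

Independent : Config → Set
Independent ω = ∀ u v → Adjacent u v → Occupied ω u → ¬ Occupied ω v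

Maximal : Config → Set
Maximal ω = ∀ u → ¬ Occupied ω u → ∃[ v ] (Adjacent u v × Occupied ω v)

InX : Config → Set
InX ω = Independent ω × Maximal ω

Triangle : Set
Triangle = Site × Site × Site

-- The Cartesian cross product equals (√3/2)·det, so the triangle is
-- non-degenerate iff det ≠ 0, and its Euclidean area is (√3/4)·|det|.
det : Triangle → ℤ
det ((ax , ay) , (bx , by) , (cx , cy)) =
  (bx ℤ.- ax) ℤ.* (cy ℤ.- ay) ℤ.- (by ℤ.- ay) ℤ.* (cx ℤ.- ax)

NonDegenerate : Triangle → Set
NonDegenerate t = ¬ (det t ≡ + 0)

-- 16 · (area of t)²  =  16 · (3/16) · det²  =  3 · det².
sixteenAreaSq : Triangle → ℤ
sixteenAreaSq t = + 3 ℤ.* (det t ℤ.* det t)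

-- A point c of the plane is a circumcentre of t if it is equidistant
-- from the three vertices.  (For a non-degenerate lattice triangle the
-- circumcentre is unique and has rational coordinates in (b₁ , b₂).)
IsCircumcentre : PointQ → Triangle → Set
IsCircumcentre c (a , b , d) =
  (distSqℚ c (toQ a) ≡ distSqℚ c (toQ b)) × (distSqℚ c (toQ a) ≡ distSqℚ c (toQ d))

EmptyCircumcircle : Config → Triangle → Set
EmptyCircumcircle ω t@(a , _ , _) =
  ∀ c → IsCircumcentre c t →
  ∀ p → Occupied ω p → ¬ (distSqℚ c (toQ p) ℚ.< distSqℚ c (toQ a))

DelaunayTriangle : Config → Triangle → Set
DelaunayTriangle ω t@(a , b , c) =
  Occupied ω a × Occupied ω b × Occupied ω c × NonDegenerate t × EmptyCircumcircle ω t

Regular : Triangle → Set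
Regular (a , b , c) = (distSq a b ≡ + 7) × (distSq b c ≡ + 7) × (distSq c a ≡ + 7)

Defective : Triangle → Set
Defective t = ¬ Regular t

module Submission where

-- The Voronoi cell of a lattice site is a hexagon of circumradius 1/√3, so the site k
-- nearest to a point x of the plane lies within 1/√3 of x and each of the six neighbours of k
-- within √(7/3); hence every point of the plane is within √(7/3) of an occupied site.  Applied to
-- the circumcentre of a Delaunay triangle, whose open circumdisc contains no occupied site, this
-- gives R² ≤ 7/3.  Every side is a chord, so its squared length is at most 4R² ≤ 28/3 and, in
-- lattice coordinates, the edge vectors u, v at one vertex lie in [-3, 3]².  Since
-- R² = |u|²|v|²|u - v|² / (16 · area²) and 16 · area² = 3 · det², the bound reads
-- |u|²|v|²|u - v|² ≤ 7 · det², and a finite check shows that such a triangle is regular or has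
-- 3 · det² ≤ 108.

open import Defs
open import Data.Integer using (+_; _≤_)

open import Data.Bool using (true)
import Data.Bool.Properties as Bool
open import Data.Nat as ℕ using (ℕ; suc; s≤s)
import Data.Nat.Properties as ℕ
open import Data.Nat.Induction using (<-wellFounded)
open import Data.Integer as ℤ using (ℤ; -[1+_]; +[1+_]; _+_; _*_; _-_; -_; _<_; +≤+; +<+; ∣_∣; 0ℤ; Positive)
import Data.Integer.Properties as ℤ
open import Data.Integer.Solver using (module +-*-Solver)
open import Data.Integer.Tactic.RingSolver using (solve-∀)
import Data.Integer.Tactic.RingSolver as Ring
open import Data.Rational as ℚ using (ℚ; _/_; 1ℚ)
import Data.Rational.Properties as ℚ
open import Data.Rational.Unnormalised as ℚᵘ using (mkℚᵘ; *≡*; *<*)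
import Data.Rational.Unnormalised.Properties as ℚᵘ
import Data.Rational.Solver as ℚ-Solver
open import Data.Product using (_×_; _,_; ∃; ∃-syntax)
open import Data.Sum using (_⊎_; inj₁; inj₂; fromInj₁)
open import Data.List using (List; _∷_; []; applyUpTo; _++_; cartesianProduct)
open import Data.List.Membership.Propositional using (_∈_; find; lose)
open import Data.List.Membership.Propositional.Properties
  using (∈-applyUpTo⁺; ∈-++⁺ˡ; ∈-++⁺ʳ; ∈-cartesianProduct⁺)
open import Data.List.Relation.Unary.All as All using (All; all?)
open import Data.List.Relation.Unary.Any using (any?)
open import Induction.WellFounded using (Acc; acc)
open import Relation.Nullary using (Dec; yes; no; contradiction)
open import Relation.Nullary.Decidable using (from-yes; _×-dec_; _⊎-dec_; _→-dec_)
open import Relation.Binary.PropositionalEquality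

0≤i*j : ∀ {i j} → 0ℤ ≤ i → 0ℤ ≤ j → 0ℤ ≤ i * j
0≤i*j {i} {j} 0≤i 0≤j = ℤ.*-monoʳ-≤-nonNeg j {{ℤ.nonNegative 0≤j}} 0≤i

0≤i*i : ∀ i → 0ℤ ≤ i * i
0≤i*i (+ n)    = 0≤i*j {+ n} {+ n} (+≤+ ℕ.z≤n) (+≤+ ℕ.z≤n)
0≤i*i -[1+ n ] = +≤+ ℕ.z≤n

≤-by-difference : ∀ {i j} k → j - i ≡ k → 0ℤ ≤ k → i ≤ j
≤-by-difference k j-i≡k 0≤k = ℤ.0≤i-j⇒j≤i (subst (0ℤ ≤_) (sym j-i≡k) 0≤k)

i≤i-j+k⇒j≤k : ∀ {i j k} → i ≤ i - j + k → j ≤ k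
i≤i-j+k⇒j≤k {i} {j} {k} i≤i-j+k =
  ≤-by-difference (i - j + k - i) (Ring.solve (i ∷ j ∷ k ∷ [])) (ℤ.i≤j⇒0≤j-i i≤i-j+k)

i*i<m*m⇒∣i∣<m : ∀ i m → i * i < + (m ℕ.* m) → ∣ i ∣ ℕ.< m
i*i<m*m⇒∣i∣<m i m i*i<m*m = ℕ.≰⇒> λ m≤∣i∣ → ℤ.<⇒≱ i*i<m*m (begin
  + (m ℕ.* m)           ≤⟨ +≤+ (ℕ.*-mono-≤ m≤∣i∣ m≤∣i∣) ⟩
  + (∣ i ∣ ℕ.* ∣ i ∣)   ≡⟨ cong +_ (ℤ.abs-* i i) ⟨
  + ∣ i * i ∣           ≡⟨ ℤ.0≤i⇒+∣i∣≡i (0≤i*i i) ⟩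
  i * i                 ∎)
  where open ℤ.≤-Reasoning

infixl 6 _+ᵥ_ _-ᵥ_
infixr 7 _*ₗ_
infix  8 -ᵥ_
infixl 7 _∙_

_+ᵥ_ _-ᵥ_ : Site → Site → Site
(x₁ , y₁) +ᵥ (x₂ , y₂) = (x₁ + x₂ , y₁ + y₂)
(x₁ , y₁) -ᵥ (x₂ , y₂) = (x₁ - x₂ , y₁ - y₂)

-ᵥ_ : Site → Site
-ᵥ (x , y) = (- x , - y)

_*ₗ_ : ℤ → Site → Site
i *ₗ (x , y) = (i * x , i * y)

∥_∥² : Site → ℤ
∥ (x , y) ∥² = normSqℤ x y

-- Twice the Euclidean inner product of x₁b₁ + y₁b₂ and x₂b₁ + y₂b₂, so that it is integral.
_∙_ : Site → Site → ℤ
(x₁ , y₁) ∙ (x₂ , y₂) = + 2 * x₁ * x₂ + x₁ * y₂ + y₁ * x₂ + + 2 * y₁ * y₂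

cross : Site → Site → ℤ
cross (x₁ , y₁) (x₂ , y₂) = x₁ * y₂ - y₁ * x₂

-- The operations above on pairs of solver polynomials: each identity below is proved by `solve`
-- on a statement whose evaluation is definitionally the identity on sites.
module Polynomials where
  open +-*-Solver public

  infixl 6 _+ₑ_ _-ₑ_
  infixr 7 _*ₑ_
  infixl 7 _∙ₑ_

  Pair : ℕ → Set
  Pair n = Polynomial n × Polynomial n

  _+ₑ_ _-ₑ_ : ∀ {n} → Pair n → Pair n → Pair n
  (x₁ , y₁) +ₑ (x₂ , y₂) = (x₁ :+ x₂ , y₁ :+ y₂)
  (x₁ , y₁) -ₑ (x₂ , y₂) = (x₁ :- x₂ , y₁ :- y₂)

  _*ₑ_ : ∀ {n} → Polynomial n → Pair n → Pair n
  i *ₑ (x , y) = (i :* x , i :* y)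

  ∥_∥ₑ² : ∀ {n} → Pair n → Polynomial n
  ∥ (x , y) ∥ₑ² = x :* x :+ x :* y :+ y :* y

  _∙ₑ_ : ∀ {n} → Pair n → Pair n → Polynomial n
  (x₁ , y₁) ∙ₑ (x₂ , y₂) = con (+ 2) :* x₁ :* x₂ :+ x₁ :* y₂ :+ y₁ :* x₂ :+ con (+ 2) :* y₁ :* y₂

  crossₑ : ∀ {n} → Pair n → Pair n → Polynomial n
  crossₑ (x₁ , y₁) (x₂ , y₂) = x₁ :* y₂ :- y₁ :* x₂

4∥x,y∥² : ∀ x y → + 4 * ∥ (x , y) ∥² ≡ (+ 2 * x + y) * (+ 2 * x + y) + + 3 * (y * y)
4∥x,y∥² = solve 2 (λ x y →
  con (+ 4) :* ∥ (x , y) ∥ₑ² := (con (+ 2) :* x :+ y) :* (con (+ 2) :* x :+ y) :+ con (+ 3) :* (y :* y)) refl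
  where open Polynomials

∥x,y∥²≡∥y,x∥² : ∀ x y → ∥ (x , y) ∥² ≡ ∥ (y , x) ∥²
∥x,y∥²≡∥y,x∥² = solve 2 (λ x y → ∥ (x , y) ∥ₑ² := ∥ (y , x) ∥ₑ²) refl
  where open Polynomials

∥-ᵥp∥²≡∥p∥² : ∀ p → ∥ -ᵥ p ∥² ≡ ∥ p ∥²
∥-ᵥp∥²≡∥p∥² (x , y) = solve 2 (λ x y → ∥ (:- x , :- y) ∥ₑ² := ∥ (x , y) ∥ₑ²) refl x y
  where open Polynomials

∙-negˡ : ∀ p q → (-ᵥ p) ∙ q ≡ - (p ∙ q)
∙-negˡ (x , y) (a , b) = solve 4 (λ x y a b → (:- x , :- y) ∙ₑ (a , b) := :- ((x , y) ∙ₑ (a , b))) refl x y a b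
  where open Polynomials

∙-negʳ : ∀ p q → p ∙ (-ᵥ q) ≡ - (p ∙ q)
∙-negʳ (x , y) (a , b) = solve 4 (λ x y a b → (x , y) ∙ₑ (:- a , :- b) := :- ((x , y) ∙ₑ (a , b))) refl x y a b
  where open Polynomials

distSq-sym : ∀ p q → distSq p q ≡ distSq q p
distSq-sym (p₁ , p₂) (q₁ , q₂) = solve 4 (λ p₁ p₂ q₁ q₂ →
  ∥ (p₁ , p₂) -ₑ (q₁ , q₂) ∥ₑ² := ∥ (q₁ , q₂) -ₑ (p₁ , p₂) ∥ₑ²) refl p₁ p₂ q₁ q₂
  where open Polynomials

distSq-translate : ∀ a p q → distSq p q ≡ distSq (p -ᵥ a) (q -ᵥ a)
distSq-translate (a₁ , a₂) (p₁ , p₂) (q₁ , q₂) = solve 6 (λ a₁ a₂ p₁ p₂ q₁ q₂ →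
  let a = (a₁ , a₂); p = (p₁ , p₂); q = (q₁ , q₂) in ∥ p -ₑ q ∥ₑ² := ∥ (p -ₑ a) -ₑ (q -ₑ a) ∥ₑ²)
  refl a₁ a₂ p₁ p₂ q₁ q₂
  where open Polynomials

k-ᵥ[k-ᵥv]≡v : ∀ k v → k -ᵥ (k -ᵥ v) ≡ v
k-ᵥ[k-ᵥv]≡v (k₁ , k₂) (v₁ , v₂) = cong₂ _,_ (i-[i-j]≡j k₁ v₁) (i-[i-j]≡j k₂ v₂)
  where
  i-[i-j]≡j : ∀ i j → i - (i - j) ≡ j
  i-[i-j]≡j = solve-∀

3y²≤4∥x,y∥² : ∀ x y → + 3 * (y * y) ≤ + 4 * ∥ (x , y) ∥²
3y²≤4∥x,y∥² x y = begin
  + 3 * (y * y)                                    ≤⟨ ℤ.i≤j+i _ _ {{ℤ.nonNegative (0≤i*i (+ 2 * x + y))}} ⟩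
  (+ 2 * x + y) * (+ 2 * x + y) + + 3 * (y * y)    ≡⟨ 4∥x,y∥² x y ⟨
  + 4 * ∥ (x , y) ∥²                               ∎
  where open ℤ.≤-Reasoning

0≤∥p∥² : ∀ p → 0ℤ ≤ ∥ p ∥²
0≤∥p∥² (x , y) = ℤ.*-cancelˡ-≤-pos 0ℤ ∥ (x , y) ∥² (+ 4)
  (ℤ.≤-trans (0≤i*j {+ 3} (+≤+ ℕ.z≤n) (0≤i*i y)) (3y²≤4∥x,y∥² x y))

interval : ℕ → List ℤ
interval r = applyUpTo +_ (suc r) ++ applyUpTo -[1+_] r

square : ℕ → List Site
square r = cartesianProduct (interval r) (interval r)

∈-interval : ∀ {r} i → ∣ i ∣ ℕ.≤ r → i ∈ interval r
∈-interval     (+ n)    n≤r = ∈-++⁺ˡ (∈-applyUpTo⁺ +_ (s≤s n≤r))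
∈-interval {r} -[1+ n ] n<r = ∈-++⁺ʳ (applyUpTo +_ (suc r)) (∈-applyUpTo⁺ -[1+_] n<r)

∈-square : ∀ r p → + 4 * ∥ p ∥² < + 3 * + (suc r ℕ.* suc r) → p ∈ square r
∈-square r (x , y) 4∥p∥²<3m² = ∈-cartesianProduct⁺
  (∈-interval x (ℕ.≤-pred (∣y∣<1+r y x (subst (λ q → + 4 * q < _) (∥x,y∥²≡∥y,x∥² x y) 4∥p∥²<3m²))))
  (∈-interval y (ℕ.≤-pred (∣y∣<1+r x y 4∥p∥²<3m²)))
  where
  ∣y∣<1+r : ∀ x y → + 4 * ∥ (x , y) ∥² < + 3 * + (suc r ℕ.* suc r) → ∣ y ∣ ℕ.< suc r
  ∣y∣<1+r x y 4∥p∥²<3m² = i*i<m*m⇒∣i∣<m y (suc r)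
    (ℤ.*-cancelˡ-<-nonNeg (+ 3) (ℤ.≤-<-trans (3y²≤4∥x,y∥² x y) 4∥p∥²<3m²))

unit∈square1 : ∀ d → ∥ d ∥² ≡ + 1 → d ∈ square 1
unit∈square1 d unit = ∈-square 1 d (subst (λ q → + 4 * q < + 12) (sym unit) (+<+ (ℕ.<ᵇ⇒< 4 12 _)))

-- On each of the six sectors cut out by the signs of A, B and B - A, the difference
-- N² - (A² - AB + B²) is a sum of two products of nonnegative factors.
hexagon-bound : ∀ {N A B} → A ≤ N → - A ≤ N → B ≤ N → - B ≤ N → B - A ≤ N → - (B - A) ≤ N →
                A * A - A * B + B * B ≤ N * N
hexagon-bound {N} {A} {B} A≤N -A≤N B≤N -B≤N C≤N -C≤N =
  by-signs (ℤ.≤-total 0ℤ A) (ℤ.≤-total 0ℤ B) (ℤ.≤-total 0ℤ (B - A))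
  where
  flip : ∀ {X} → X ≤ 0ℤ → 0ℤ ≤ - X
  flip = ℤ.neg-mono-≤

  by : ∀ {X S T} → X ≤ N → - X ≤ N → 0ℤ ≤ S → 0ℤ ≤ T →
       N * N - (A * A - A * B + B * B) ≡ (N - X) * (N - - X) + S * T → A * A - A * B + B * B ≤ N * N
  by X≤N -X≤N 0≤S 0≤T eq =
    ≤-by-difference _ eq (ℤ.+-mono-≤ (0≤i*j (ℤ.i≤j⇒0≤j-i X≤N) (ℤ.i≤j⇒0≤j-i -X≤N)) (0≤i*j 0≤S 0≤T))

  by-signs : 0ℤ ≤ A ⊎ A ≤ 0ℤ → 0ℤ ≤ B ⊎ B ≤ 0ℤ → 0ℤ ≤ B - A ⊎ B - A ≤ 0ℤ → A * A - A * B + B * B ≤ N * N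
  by-signs (inj₁ 0≤A) (inj₁ 0≤B) (inj₂ C≤0) = by A≤N -A≤N 0≤B (flip C≤0) (Ring.solve (N ∷ A ∷ B ∷ []))
  by-signs (inj₁ 0≤A) (inj₁ 0≤B) (inj₁ 0≤C) = by B≤N -B≤N 0≤A 0≤C (Ring.solve (N ∷ A ∷ B ∷ []))
  by-signs (inj₁ 0≤A) (inj₂ B≤0) _          = by C≤N -C≤N 0≤A (flip B≤0) (Ring.solve (N ∷ A ∷ B ∷ []))
  by-signs (inj₂ A≤0) (inj₁ 0≤B) _          = by C≤N -C≤N (flip A≤0) 0≤B (Ring.solve (N ∷ A ∷ B ∷ []))
  by-signs (inj₂ A≤0) (inj₂ B≤0) (inj₁ 0≤C) = by A≤N -A≤N (flip B≤0) 0≤C (Ring.solve (N ∷ A ∷ B ∷ []))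
  by-signs (inj₂ A≤0) (inj₂ B≤0) (inj₂ C≤0) = by B≤N -B≤N (flip A≤0) (flip C≤0) (Ring.solve (N ∷ A ∷ B ∷ []))

-- p ∙ d ≤ N says that p is no farther from 0 than from the lattice point N d.
InVoronoiCell : ℤ → Site → Set
InVoronoiCell N p = ∀ d → ∥ d ∥² ≡ + 1 → p ∙ d ≤ N

voronoi-covering-radius : ∀ {N} p → InVoronoiCell N p → + 3 * ∥ p ∥² ≤ N * N
voronoi-covering-radius {N} p@(x , y) cell = subst (_≤ N * N) (sym 3∥p∥²≡) (hexagon-bound
  (along e₁ p∙e₁≡A refl) (along (-ᵥ e₁) (opposite e₁ p∙e₁≡A) refl)
  (along e₂ p∙e₂≡B refl) (along (-ᵥ e₂) (opposite e₂ p∙e₂≡B) refl)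
  (along e₃ p∙e₃≡B-A refl) (along (-ᵥ e₃) (opposite e₃ p∙e₃≡B-A) refl))
  where
  open Polynomials
  e₁ e₂ e₃ : Site
  e₁ = (+ 1 , + 0)
  e₂ = (+ 0 , + 1)
  e₃ = (-[1+ 0 ] , + 1)
  A B : ℤ
  A = + 2 * x + y
  B = x + + 2 * y
  along : ∀ d {X} → p ∙ d ≡ X → ∥ d ∥² ≡ + 1 → X ≤ N
  along d p∙d≡X unit = subst (_≤ N) p∙d≡X (cell d unit)
  opposite : ∀ d {X} → p ∙ d ≡ X → p ∙ (-ᵥ d) ≡ - X
  opposite d p∙d≡X = trans (∙-negʳ p d) (cong -_ p∙d≡X)
  p∙e₁≡A : p ∙ e₁ ≡ A
  p∙e₁≡A = solve 2 (λ x y → (x , y) ∙ₑ (con (+ 1) , con (+ 0)) := con (+ 2) :* x :+ y) refl x y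
  p∙e₂≡B : p ∙ e₂ ≡ B
  p∙e₂≡B = solve 2 (λ x y → (x , y) ∙ₑ (con (+ 0) , con (+ 1)) := x :+ con (+ 2) :* y) refl x y
  p∙e₃≡B-A : p ∙ e₃ ≡ B - A
  p∙e₃≡B-A = solve 2 (λ x y → (x , y) ∙ₑ (con -[1+ 0 ] , con (+ 1))
                             := (x :+ con (+ 2) :* y) :- (con (+ 2) :* x :+ y)) refl x y
  3∥p∥²≡ : + 3 * ∥ p ∥² ≡ A * A - A * B + B * B
  3∥p∥²≡ = solve 2 (λ x y → con (+ 3) :* ∥ (x , y) ∥ₑ²
                          := (con (+ 2) :* x :+ y) :* (con (+ 2) :* x :+ y)
                             :- (con (+ 2) :* x :+ y) :* (x :+ con (+ 2) :* y)
                             :+ (x :+ con (+ 2) :* y) :* (x :+ con (+ 2) :* y)) refl x y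

-- A point of the plane is represented as z / N with z a site and N > 0; then distSq z (N *ₗ k)
-- is N² times its squared distance to the site k.
LocallyNearest : ℤ → Site → Site → Set
LocallyNearest N z k = ∀ d → ∥ d ∥² ≡ + 1 → distSq z (N *ₗ k) ≤ distSq z (N *ₗ (k +ᵥ d))

distSq-+ᵥ : ∀ N z k d →
  distSq z (N *ₗ (k +ᵥ d)) ≡ distSq z (N *ₗ k) - N * ((z -ᵥ N *ₗ k) ∙ d) + N * N * ∥ d ∥²
distSq-+ᵥ N (z₁ , z₂) (k₁ , k₂) (d₁ , d₂) = solve 7 (λ N z₁ z₂ k₁ k₂ d₁ d₂ →
  let z = (z₁ , z₂); k = (k₁ , k₂); d = (d₁ , d₂) in
  ∥ z -ₑ N *ₑ (k +ₑ d) ∥ₑ² := ∥ z -ₑ N *ₑ k ∥ₑ² :- N :* ((z -ₑ N *ₑ k) ∙ₑ d) :+ N :* N :* ∥ d ∥ₑ²)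
  refl N z₁ z₂ k₁ k₂ d₁ d₂
  where open Polynomials

distSq--ᵥ : ∀ N z k d →
  distSq z (N *ₗ (k -ᵥ d)) ≡ distSq z (N *ₗ k) + N * ((z -ᵥ N *ₗ k) ∙ d) + N * N * ∥ d ∥²
distSq--ᵥ N (z₁ , z₂) (k₁ , k₂) (d₁ , d₂) = solve 7 (λ N z₁ z₂ k₁ k₂ d₁ d₂ →
  let z = (z₁ , z₂); k = (k₁ , k₂); d = (d₁ , d₂) in
  ∥ z -ₑ N *ₑ (k -ₑ d) ∥ₑ² := ∥ z -ₑ N *ₑ k ∥ₑ² :+ N :* ((z -ₑ N *ₑ k) ∙ₑ d) :+ N :* N :* ∥ d ∥ₑ²)
  refl N z₁ z₂ k₁ k₂ d₁ d₂
  where open Polynomials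

nearest⇒voronoi : ∀ N .{{_ : Positive N}} z k → LocallyNearest N z k → InVoronoiCell N (z -ᵥ N *ₗ k)
nearest⇒voronoi N z k nearest d unit = ℤ.*-cancelˡ-≤-pos _ _ N (i≤i-j+k⇒j≤k (begin
  g                                   ≤⟨ nearest d unit ⟩
  distSq z (N *ₗ (k +ᵥ d))            ≡⟨ distSq-+ᵥ N z k d ⟩
  g - N * P + N * N * ∥ d ∥²          ≡⟨ cong (λ q → g - N * P + N * N * q) unit ⟩
  g - N * P + N * N * + 1             ≡⟨ cong (λ q → g - N * P + q) (ℤ.*-identityʳ (N * N)) ⟩
  g - N * P + N * N                   ∎))
  where
  open ℤ.≤-Reasoning
  g P : ℤ
  g = distSq z (N *ₗ k)
  P = (z -ᵥ N *ₗ k) ∙ d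

nearest-bound : ∀ N .{{_ : Positive N}} z k → LocallyNearest N z k → + 3 * distSq z (N *ₗ k) ≤ N * N
nearest-bound N z k nearest = voronoi-covering-radius (z -ᵥ N *ₗ k) (nearest⇒voronoi N z k nearest)

nearest-neighbour-bound : ∀ N .{{_ : Positive N}} z k → LocallyNearest N z k →
  ∀ d → ∥ d ∥² ≡ + 1 → + 3 * distSq z (N *ₗ (k -ᵥ d)) ≤ + 7 * (N * N)
nearest-neighbour-bound N z k nearest d unit = begin
  + 3 * distSq z (N *ₗ (k -ᵥ d))                     ≡⟨ cong (+ 3 *_) (distSq--ᵥ N z k d) ⟩
  + 3 * (g + N * P + N * N * ∥ d ∥²)                 ≡⟨ cong (λ q → + 3 * (g + N * P + N * N * q)) unit ⟩
  + 3 * (g + N * P + N * N * + 1)                    ≡⟨ distrib g (N * P) (N * N) ⟩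
  + 3 * g + + 3 * (N * P) + + 3 * (N * N)            ≤⟨ ℤ.+-monoˡ-≤ (+ 3 * (N * N)) (ℤ.+-mono-≤
                                                         (nearest-bound N z k nearest)
                                                         (ℤ.*-monoˡ-≤-nonNeg (+ 3) (ℤ.*-monoˡ-≤-nonNeg N {{0≤N}}
                                                           (nearest⇒voronoi N z k nearest d unit)))) ⟩
  N * N + + 3 * (N * N) + + 3 * (N * N)              ≡⟨ Ring.solve (N ∷ []) ⟩
  + 7 * (N * N)                                      ∎
  where
  open ℤ.≤-Reasoning
  g P : ℤ
  g = distSq z (N *ₗ k)
  P = (z -ᵥ N *ₗ k) ∙ d
  0≤N : ℤ.NonNegative N
  0≤N = ℤ.nonNegative (ℤ.<⇒≤ (ℤ.positive⁻¹ N))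
  distrib : ∀ a b c → + 3 * (a + b + c * + 1) ≡ + 3 * a + + 3 * b + + 3 * c
  distrib = solve-∀

nearest-exists : ∀ N .{{_ : Positive N}} z → ∃ (LocallyNearest N z)
nearest-exists N z = descend (0ℤ , 0ℤ) (<-wellFounded _)
  where
  g : Site → ℤ
  g k = distSq z (N *ₗ k)

  +∣g∣≡g : ∀ k → + ∣ g k ∣ ≡ g k
  +∣g∣≡g k = ℤ.0≤i⇒+∣i∣≡i (0≤∥p∥² (z -ᵥ N *ₗ k))

  descend : ∀ k → Acc ℕ._<_ ∣ g k ∣ → ∃ (LocallyNearest N z)
  descend k (acc smaller) with any? (λ d → (∥ d ∥² ℤ.≟ + 1) ×-dec (g (k +ᵥ d) ℤ.<? g k)) (square 1)
  ... | yes closer = let d , _ , _ , g[k+d]<g[k] = find closer in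
    descend (k +ᵥ d) (smaller (ℤ.drop‿+<+ (subst₂ _<_ (sym (+∣g∣≡g (k +ᵥ d))) (sym (+∣g∣≡g k)) g[k+d]<g[k])))
  ... | no none-closer = k , λ d unit → ℤ.≮⇒≥ λ g[k+d]<g[k] →
    none-closer (lose (unit∈square1 d unit) (unit , g[k+d]<g[k]))

maximal⇒occupied-nearby : ∀ {ω} → Maximal ω → ∀ N .{{_ : Positive N}} z →
  ∃[ p ] Occupied ω p × + 3 * distSq z (N *ₗ p) ≤ + 7 * (N * N)
maximal⇒occupied-nearby {ω} maximal N z with nearest-exists N z
... | k , nearest with ω k Bool.≟ true
...   | yes occupied = k , occupied , ℤ.≤-trans (nearest-bound N z k nearest) N²≤7N²
  where
  N²≤7N² : N * N ≤ + 7 * (N * N)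
  N²≤7N² = subst (_≤ + 7 * (N * N)) (ℤ.*-identityˡ (N * N))
             (ℤ.*-monoʳ-≤-nonNeg (N * N) {{ℤ.nonNegative (0≤i*i N)}} {+ 1} {+ 7} (+≤+ (s≤s ℕ.z≤n)))
...   | no unoccupied =
  let v , adjacent , occupied = maximal k unoccupied in
  v , occupied , subst (λ v → + 3 * distSq z (N *ₗ v) ≤ + 7 * (N * N)) (k-ᵥ[k-ᵥv]≡v k v)
                       (nearest-neighbour-bound N z k nearest (k -ᵥ v) adjacent)

-- Scaled by 3 · cross u v, the circumcentre of the triangle 0, u, v: the solution c of
-- c ∙ u = 3 · cross u v · ∥ u ∥² and c ∙ v = 3 · cross u v · ∥ v ∥² by Cramer's rule.
circumcentre : Site → Site → Site
circumcentre u@(u₁ , u₂) v@(v₁ , v₂) =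
  ( ∥ u ∥² * (v₁ + + 2 * v₂) - ∥ v ∥² * (u₁ + + 2 * u₂)
  , (+ 2 * u₁ + u₂) * ∥ v ∥² - (+ 2 * v₁ + v₂) * ∥ u ∥² )

module _ where
  open Polynomials

  private
    circumcentreₑ : ∀ {n} → Pair n → Pair n → Pair n
    circumcentreₑ u@(u₁ , u₂) v@(v₁ , v₂) =
      ( ∥ u ∥ₑ² :* (v₁ :+ con (+ 2) :* v₂) :- ∥ v ∥ₑ² :* (u₁ :+ con (+ 2) :* u₂)
      , (con (+ 2) :* u₁ :+ u₂) :* ∥ v ∥ₑ² :- (con (+ 2) :* v₁ :+ v₂) :* ∥ u ∥ₑ² )

  circumcentre-∙ˡ : ∀ u v → circumcentre u v ∙ u ≡ + 3 * cross u v * ∥ u ∥²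
  circumcentre-∙ˡ (u₁ , u₂) (v₁ , v₂) = solve 4 (λ u₁ u₂ v₁ v₂ → let u = (u₁ , u₂); v = (v₁ , v₂) in
    circumcentreₑ u v ∙ₑ u := con (+ 3) :* crossₑ u v :* ∥ u ∥ₑ²) refl u₁ u₂ v₁ v₂

  circumcentre-∙ʳ : ∀ u v → circumcentre u v ∙ v ≡ + 3 * cross u v * ∥ v ∥²
  circumcentre-∙ʳ (u₁ , u₂) (v₁ , v₂) = solve 4 (λ u₁ u₂ v₁ v₂ → let u = (u₁ , u₂); v = (v₁ , v₂) in
    circumcentreₑ u v ∙ₑ v := con (+ 3) :* crossₑ u v :* ∥ v ∥ₑ²) refl u₁ u₂ v₁ v₂

  ∥circumcentre∥² : ∀ u v → ∥ circumcentre u v ∥² ≡ + 3 * (∥ u ∥² * ∥ v ∥² * ∥ u -ᵥ v ∥²)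
  ∥circumcentre∥² (u₁ , u₂) (v₁ , v₂) = solve 4 (λ u₁ u₂ v₁ v₂ → let u = (u₁ , u₂); v = (v₁ , v₂) in
    ∥ circumcentreₑ u v ∥ₑ² := con (+ 3) :* (∥ u ∥ₑ² :* ∥ v ∥ₑ² :* ∥ u -ₑ v ∥ₑ²)) refl u₁ u₂ v₁ v₂

-- centre /1+ n is the circumcentre of the triangle 0, u, v.
record ScaledCircumcentre (u v : Site) : Set where
  field
    n            : ℕ
    centre       : Site
    centre∙u     : centre ∙ u ≡ + suc n * ∥ u ∥²
    centre∙v     : centre ∙ v ≡ + suc n * ∥ v ∥²
    ∥centre∥²    : ∥ centre ∥² ≡ + 3 * (∥ u ∥² * ∥ v ∥² * ∥ u -ᵥ v ∥²)
    denominator² : + suc n * + suc n ≡ + 9 * (cross u v * cross u v)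

-- The equations for (centre , denominator) are linear, so negating both makes the denominator positive.
scaled-circumcentre : ∀ u v → cross u v ≢ 0ℤ → ScaledCircumcentre u v
scaled-circumcentre u v D≢0 = with-denominator (+ 3 * cross u v) refl
  where
  D : ℤ
  D = cross u v
  c : Site
  c = circumcentre u v

  M*M≡9D² : ∀ {M} → + 3 * D ≡ M → M * M ≡ + 9 * (D * D)
  M*M≡9D² refl = square-3D D
    where
    square-3D : ∀ D → + 3 * D * (+ 3 * D) ≡ + 9 * (D * D)
    square-3D = solve-∀

  with-denominator : ∀ M → + 3 * D ≡ M → ScaledCircumcentre u v
  with-denominator (+ 0) 3D≡0 with ℤ.i*j≡0⇒i≡0∨j≡0 (+ 3) 3D≡0
  ... | inj₂ D≡0 = contradiction D≡0 D≢0
  with-denominator +[1+ n ] 3D≡M = record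
    { n = n ; centre = c
    ; centre∙u = trans (circumcentre-∙ˡ u v) (cong (_* ∥ u ∥²) 3D≡M)
    ; centre∙v = trans (circumcentre-∙ʳ u v) (cong (_* ∥ v ∥²) 3D≡M)
    ; ∥centre∥² = ∥circumcentre∥² u v
    ; denominator² = M*M≡9D² 3D≡M
    }
  with-denominator -[1+ n ] 3D≡M = record
    { n = n ; centre = -ᵥ c
    ; centre∙u = negate u (circumcentre-∙ˡ u v)
    ; centre∙v = negate v (circumcentre-∙ʳ u v)
    ; ∥centre∥² = trans (∥-ᵥp∥²≡∥p∥² c) (∥circumcentre∥² u v)
    ; denominator² = M*M≡9D² 3D≡M
    }
    where
    negate : ∀ w → c ∙ w ≡ + 3 * D * ∥ w ∥² → (-ᵥ c) ∙ w ≡ + suc n * ∥ w ∥²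
    negate w c∙w≡ = begin
      (-ᵥ c) ∙ w                ≡⟨ ∙-negˡ c w ⟩
      - (c ∙ w)                 ≡⟨ cong -_ (trans c∙w≡ (cong (_* ∥ w ∥²) 3D≡M)) ⟩
      - (-[1+ n ] * ∥ w ∥²)     ≡⟨ ℤ.neg-distribˡ-* -[1+ n ] ∥ w ∥² ⟩
      + suc n * ∥ w ∥²          ∎
      where open ≡-Reasoning

ι : ℤ → ℚ
ι i = i / 1

toℚᵘ-ι : ∀ i → ℚ.toℚᵘ (ι i) ℚᵘ.≃ mkℚᵘ i 0
toℚᵘ-ι i = ℚ.toℚᵘ-fromℚᵘ (mkℚᵘ i 0)

ι-+ : ∀ i j → ι (i + j) ≡ ι i ℚ.+ ι j
ι-+ i j = ℚ.toℚᵘ-injective (begin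
  ℚ.toℚᵘ (ι (i + j))                 ≈⟨ toℚᵘ-ι (i + j) ⟩
  mkℚᵘ (i + j) 0                     ≈⟨ *≡* (identity i j) ⟩
  mkℚᵘ i 0 ℚᵘ.+ mkℚᵘ j 0             ≈⟨ ℚᵘ.+-cong (toℚᵘ-ι i) (toℚᵘ-ι j) ⟨
  ℚ.toℚᵘ (ι i) ℚᵘ.+ ℚ.toℚᵘ (ι j)    ≈⟨ ℚ.toℚᵘ-homo-+ (ι i) (ι j) ⟨
  ℚ.toℚᵘ (ι i ℚ.+ ι j)              ∎)
  where
  open ℚᵘ.≃-Reasoning
  identity : ∀ i j → (i + j) * + 1 ≡ (i * + 1 + j * + 1) * + 1
  identity = solve-∀

ι-* : ∀ i j → ι (i * j) ≡ ι i ℚ.* ι j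
ι-* i j = ℚ.toℚᵘ-injective (begin
  ℚ.toℚᵘ (ι (i * j))                 ≈⟨ toℚᵘ-ι (i * j) ⟩
  mkℚᵘ (i * j) 0                     ≈⟨ ℚᵘ.*-cong (toℚᵘ-ι i) (toℚᵘ-ι j) ⟨
  ℚ.toℚᵘ (ι i) ℚᵘ.* ℚ.toℚᵘ (ι j)    ≈⟨ ℚ.toℚᵘ-homo-* (ι i) (ι j) ⟨
  ℚ.toℚᵘ (ι i ℚ.* ι j)              ∎)
  where open ℚᵘ.≃-Reasoning

ι-neg : ∀ i → ι (- i) ≡ ℚ.- ι i
ι-neg i = ℚ.toℚᵘ-injective (begin
  ℚ.toℚᵘ (ι (- i))                   ≈⟨ toℚᵘ-ι (- i) ⟩
  mkℚᵘ (- i) 0                       ≈⟨ ℚᵘ.-‿cong (toℚᵘ-ι i) ⟨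
  ℚᵘ.- ℚ.toℚᵘ (ι i)                  ≈⟨ ℚ.toℚᵘ-homo‿- (ι i) ⟨
  ℚ.toℚᵘ (ℚ.- ι i)                   ∎)
  where open ℚᵘ.≃-Reasoning

ι-- : ∀ i j → ι (i - j) ≡ ι i ℚ.- ι j
ι-- i j = trans (ι-+ i (- j)) (cong (ι i ℚ.+_) (ι-neg j))

ι-normSq : ∀ x y → ι (normSqℤ x y) ≡ normSqℚ (ι x) (ι y)
ι-normSq x y = begin
  ι (x * x + x * y + y * y)               ≡⟨ ι-+ (x * x + x * y) (y * y) ⟩
  ι (x * x + x * y) ℚ.+ ι (y * y)         ≡⟨ cong₂ ℚ._+_ (ι-+ (x * x) (x * y)) (ι-* y y) ⟩
  ι (x * x) ℚ.+ ι (x * y) ℚ.+ ι y ℚ.* ι y ≡⟨ cong₂ (λ a b → a ℚ.+ b ℚ.+ ι y ℚ.* ι y) (ι-* x x) (ι-* x y) ⟩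
  normSqℚ (ι x) (ι y)                     ∎
  where open ≡-Reasoning

ι-< : ∀ {i j} → i < j → ι i ℚ.< ι j
ι-< {i} {j} i<j = ℚ.toℚᵘ-cancel-< (ℚᵘ.<-respˡ-≃ (ℚᵘ.≃-sym (toℚᵘ-ι i)) (ℚᵘ.<-respʳ-≃ (ℚᵘ.≃-sym (toℚᵘ-ι j))
  (*<* (subst₂ _<_ (sym (ℤ.*-identityʳ i)) (sym (ℤ.*-identityʳ j)) i<j))))

_/1+_ : Site → ℕ → PointQ
(x , y) /1+ n = (ι x ℚ.* (+ 1 / suc n) , ι y ℚ.* (+ 1 / suc n))

ι[1+n]*1/[1+n]≡1 : ∀ n → ι (+ suc n) ℚ.* (+ 1 / suc n) ≡ 1ℚ
ι[1+n]*1/[1+n]≡1 n = ℚ.toℚᵘ-injective (begin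
  ℚ.toℚᵘ (ι (+ suc n) ℚ.* (+ 1 / suc n))            ≈⟨ ℚ.toℚᵘ-homo-* (ι (+ suc n)) (+ 1 / suc n) ⟩
  ℚ.toℚᵘ (ι (+ suc n)) ℚᵘ.* ℚ.toℚᵘ (+ 1 / suc n)   ≈⟨ ℚᵘ.*-cong (toℚᵘ-ι (+ suc n)) (ℚ.toℚᵘ-fromℚᵘ (mkℚᵘ (+ 1) n)) ⟩
  mkℚᵘ (+ suc n) 0 ℚᵘ.* ℚᵘ.1/ mkℚᵘ (+ suc n) 0     ≈⟨ ℚᵘ.*-inverseʳ (mkℚᵘ (+ suc n) 0) ⟩
  ℚ.toℚᵘ 1ℚ                                         ∎)
  where open ℚᵘ.≃-Reasoning

distSqℚ-/1+ : ∀ n z p →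
  distSqℚ (z /1+ n) (toQ p) ≡ ((+ 1 / suc n) ℚ.* (+ 1 / suc n)) ℚ.* ι (distSq z (+ suc n *ₗ p))
distSqℚ-/1+ n (X , Y) (x , y) = sym (begin
  (w ℚ.* w) ℚ.* ι (normSqℤ (X - N * x) (Y - N * y))
    ≡⟨ cong ((w ℚ.* w) ℚ.*_) (trans (ι-normSq (X - N * x) (Y - N * y)) (cong₂ normSqℚ (ι-affine X x) (ι-affine Y y))) ⟩
  (w ℚ.* w) ℚ.* normSqℚ (ι X ℚ.- ι N ℚ.* ι x) (ι Y ℚ.- ι N ℚ.* ι y)
    ≡⟨ rescale (ι X) (ι Y) (ι N) w (ι x) (ι y) ⟩
  normSqℚ (ι X ℚ.* w ℚ.- (ι N ℚ.* w) ℚ.* ι x) (ι Y ℚ.* w ℚ.- (ι N ℚ.* w) ℚ.* ι y)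
    ≡⟨ cong (λ m → normSqℚ (ι X ℚ.* w ℚ.- m ℚ.* ι x) (ι Y ℚ.* w ℚ.- m ℚ.* ι y)) (ι[1+n]*1/[1+n]≡1 n) ⟩
  normSqℚ (ι X ℚ.* w ℚ.- 1ℚ ℚ.* ι x) (ι Y ℚ.* w ℚ.- 1ℚ ℚ.* ι y)
    ≡⟨ cong₂ (λ a b → normSqℚ (ι X ℚ.* w ℚ.- a) (ι Y ℚ.* w ℚ.- b)) (ℚ.*-identityˡ (ι x)) (ℚ.*-identityˡ (ι y)) ⟩
  distSqℚ ((X , Y) /1+ n) (toQ (x , y)) ∎)
  where
  open ≡-Reasoning
  open ℚ-Solver.+-*-Solver
  N : ℤ
  N = + suc n
  w : ℚ
  w = + 1 / suc n

  ι-affine : ∀ a b → ι (a - N * b) ≡ ι a ℚ.- ι N ℚ.* ι b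
  ι-affine a b = trans (ι-- a (N * b)) (cong (λ q → ι a ℚ.- q) (ι-* N b))

  normSqₑ : ∀ {k} → Polynomial k → Polynomial k → Polynomial k
  normSqₑ a b = a :* a :+ a :* b :+ b :* b

  rescale : ∀ X Y m w x y → (w ℚ.* w) ℚ.* normSqℚ (X ℚ.- m ℚ.* x) (Y ℚ.- m ℚ.* y)
                          ≡ normSqℚ (X ℚ.* w ℚ.- (m ℚ.* w) ℚ.* x) (Y ℚ.* w ℚ.- (m ℚ.* w) ℚ.* y)
  rescale = solve 6 (λ X Y m w x y → (w :* w) :* normSqₑ (X :- m :* x) (Y :- m :* y)
                                     := normSqₑ (X :* w :- (m :* w) :* x) (Y :* w :- (m :* w) :* y)) refl

/1+-cong : ∀ n z {p q} → distSq z (+ suc n *ₗ p) ≡ distSq z (+ suc n *ₗ q) →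
           distSqℚ (z /1+ n) (toQ p) ≡ distSqℚ (z /1+ n) (toQ q)
/1+-cong n z {p} {q} eq = begin
  distSqℚ (z /1+ n) (toQ p)                                         ≡⟨ distSqℚ-/1+ n z p ⟩
  ((+ 1 / suc n) ℚ.* (+ 1 / suc n)) ℚ.* ι (distSq z (+ suc n *ₗ p)) ≡⟨ cong (λ d → ((+ 1 / suc n) ℚ.* (+ 1 / suc n)) ℚ.* ι d) eq ⟩
  ((+ 1 / suc n) ℚ.* (+ 1 / suc n)) ℚ.* ι (distSq z (+ suc n *ₗ q)) ≡⟨ distSqℚ-/1+ n z q ⟨
  distSqℚ (z /1+ n) (toQ q)                                         ∎
  where open ≡-Reasoning

/1+-mono-< : ∀ n z {p q} → distSq z (+ suc n *ₗ p) < distSq z (+ suc n *ₗ q) →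
             distSqℚ (z /1+ n) (toQ p) ℚ.< distSqℚ (z /1+ n) (toQ q)
/1+-mono-< n z {p} {q} lt = subst₂ ℚ._<_ (sym (distSqℚ-/1+ n z p)) (sym (distSqℚ-/1+ n z q))
  (ℚ.*-monoʳ-<-pos (w ℚ.* w) {{ℚ.pos*pos⇒pos w w}} (ι-< lt))
  where
  w : ℚ
  w = + 1 / suc n
  instance
    w>0 : ℚ.Positive w
    w>0 = ℚ.normalize-pos 1 (suc n)

distSq-centre : ∀ N a c p → distSq (N *ₗ a +ᵥ c) (N *ₗ p) ≡ ∥ c ∥² - N * (c ∙ (p -ᵥ a)) + N * N * ∥ p -ᵥ a ∥²
distSq-centre N (a₁ , a₂) (c₁ , c₂) (p₁ , p₂) = solve 7 (λ N a₁ a₂ c₁ c₂ p₁ p₂ →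
  let a = (a₁ , a₂); c = (c₁ , c₂); p = (p₁ , p₂) in
  ∥ (N *ₑ a +ₑ c) -ₑ N *ₑ p ∥ₑ² := ∥ c ∥ₑ² :- N :* (c ∙ₑ (p -ₑ a)) :+ N :* N :* ∥ p -ₑ a ∥ₑ²)
  refl N a₁ a₂ c₁ c₂ p₁ p₂
  where open Polynomials

distSq-centre-self : ∀ N a c → distSq (N *ₗ a +ᵥ c) (N *ₗ a) ≡ ∥ c ∥²
distSq-centre-self N (a₁ , a₂) (c₁ , c₂) = solve 5 (λ N a₁ a₂ c₁ c₂ →
  let a = (a₁ , a₂); c = (c₁ , c₂) in ∥ (N *ₑ a +ₑ c) -ₑ N *ₑ a ∥ₑ² := ∥ c ∥ₑ²) refl N a₁ a₂ c₁ c₂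
  where open Polynomials

equidistant : ∀ N a c p → c ∙ (p -ᵥ a) ≡ N * ∥ p -ᵥ a ∥² → distSq (N *ₗ a +ᵥ c) (N *ₗ p) ≡ ∥ c ∥²
equidistant N a c p c∙[p-a]≡ = begin
  distSq (N *ₗ a +ᵥ c) (N *ₗ p)                          ≡⟨ distSq-centre N a c p ⟩
  ∥ c ∥² - N * (c ∙ (p -ᵥ a)) + N * N * ∥ p -ᵥ a ∥²      ≡⟨ cong (λ q → ∥ c ∥² - N * q + N * N * ∥ p -ᵥ a ∥²) c∙[p-a]≡ ⟩
  ∥ c ∥² - N * (N * ∥ p -ᵥ a ∥²) + N * N * ∥ p -ᵥ a ∥²   ≡⟨ cancel ∥ c ∥² N ∥ p -ᵥ a ∥² ⟩
  ∥ c ∥²                                                  ∎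
  where
  open ≡-Reasoning
  cancel : ∀ x N q → x - N * (N * q) + N * N * q ≡ x
  cancel = solve-∀

delaunay-circumradius-bound : ∀ {ω} → Maximal ω → ∀ a b c → EmptyCircumcircle ω (a , b , c) →
  (S : ScaledCircumcentre (b -ᵥ a) (c -ᵥ a)) →
  let open ScaledCircumcentre S in + 3 * ∥ centre ∥² ≤ + 7 * (+ suc n * + suc n)
delaunay-circumradius-bound maximal a b c empty S =
  let p , occupied , p-near = maximal⇒occupied-nearby maximal N z
      a-nearest : distSq z (N *ₗ a) ≤ distSq z (N *ₗ p)
      a-nearest = ℤ.≮⇒≥ λ closer → empty (z /1+ n) circumcentre-z p occupied (/1+-mono-< n z closer)
  in ℤ.≤-trans (ℤ.*-monoˡ-≤-nonNeg (+ 3) (subst (_≤ distSq z (N *ₗ p)) za≡ a-nearest)) p-near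
  where
  open ScaledCircumcentre S
  N : ℤ
  N = + suc n
  z : Site
  z = N *ₗ a +ᵥ centre

  za≡ : distSq z (N *ₗ a) ≡ ∥ centre ∥²
  za≡ = distSq-centre-self N a centre
  zb≡ : distSq z (N *ₗ b) ≡ ∥ centre ∥²
  zb≡ = equidistant N a centre b centre∙u
  zc≡ : distSq z (N *ₗ c) ≡ ∥ centre ∥²
  zc≡ = equidistant N a centre c centre∙v

  circumcentre-z : IsCircumcentre (z /1+ n) (a , b , c)
  circumcentre-z = /1+-cong n z (trans za≡ (sym zb≡)) , /1+-cong n z (trans za≡ (sym zc≡))

∥2c-Nu∥² : ∀ N c u → ∥ + 2 *ₗ c -ᵥ N *ₗ u ∥² ≡ + 4 * ∥ c ∥² - + 2 * N * (c ∙ u) + N * N * ∥ u ∥²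
∥2c-Nu∥² N (c₁ , c₂) (u₁ , u₂) = solve 5 (λ N c₁ c₂ u₁ u₂ → let c = (c₁ , c₂); u = (u₁ , u₂) in
  ∥ con (+ 2) *ₑ c -ₑ N *ₑ u ∥ₑ² := con (+ 4) :* ∥ c ∥ₑ² :- con (+ 2) :* N :* (c ∙ₑ u) :+ N :* N :* ∥ u ∥ₑ²)
  refl N c₁ c₂ u₁ u₂
  where open Polynomials

chord≤diameter : ∀ N c u → c ∙ u ≡ N * ∥ u ∥² → N * N * ∥ u ∥² ≤ + 4 * ∥ c ∥²
chord≤diameter N c u c∙u≡ = ≤-by-difference ∥ + 2 *ₗ c -ᵥ N *ₗ u ∥² (begin
  + 4 * ∥ c ∥² - N * N * ∥ u ∥²                             ≡⟨ expand ∥ c ∥² N ∥ u ∥² ⟩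
  + 4 * ∥ c ∥² - + 2 * N * (N * ∥ u ∥²) + N * N * ∥ u ∥²    ≡⟨ cong (λ q → + 4 * ∥ c ∥² - + 2 * N * q + N * N * ∥ u ∥²) c∙u≡ ⟨
  + 4 * ∥ c ∥² - + 2 * N * (c ∙ u) + N * N * ∥ u ∥²         ≡⟨ ∥2c-Nu∥² N c u ⟨
  ∥ + 2 *ₗ c -ᵥ N *ₗ u ∥²                                   ∎) (0≤∥p∥² (+ 2 *ₗ c -ᵥ N *ₗ u))
  where
  open ≡-Reasoning
  expand : ∀ x N q → + 4 * x - N * N * q ≡ + 4 * x - + 2 * N * (N * q) + N * N * q
  expand = solve-∀

side-bound : ∀ n c u → c ∙ u ≡ + suc n * ∥ u ∥² → + 3 * ∥ c ∥² ≤ + 7 * (+ suc n * + suc n) →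
  + 3 * ∥ u ∥² ≤ + 28
side-bound n c u c∙u≡ 3R²≤7 = ℤ.*-cancelʳ-≤-pos (+ 3 * ∥ u ∥²) (+ 28) (N * N) (begin
  + 3 * ∥ u ∥² * (N * N)       ≡⟨ trans (ℤ.*-assoc (+ 3) ∥ u ∥² (N * N)) (cong (+ 3 *_) (ℤ.*-comm ∥ u ∥² (N * N))) ⟩
  + 3 * (N * N * ∥ u ∥²)       ≤⟨ ℤ.*-monoˡ-≤-nonNeg (+ 3) (chord≤diameter N c u c∙u≡) ⟩
  + 3 * (+ 4 * ∥ c ∥²)         ≡⟨ trans (sym (ℤ.*-assoc (+ 3) (+ 4) ∥ c ∥²)) (ℤ.*-assoc (+ 4) (+ 3) ∥ c ∥²) ⟩
  + 4 * (+ 3 * ∥ c ∥²)         ≤⟨ ℤ.*-monoˡ-≤-nonNeg (+ 4) 3R²≤7 ⟩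
  + 4 * (+ 7 * (N * N))        ≡⟨ ℤ.*-assoc (+ 4) (+ 7) (N * N) ⟨
  + 28 * (N * N)               ∎)
  where
  open ℤ.≤-Reasoning
  N : ℤ
  N = + suc n

sides-product-bound : ∀ {u v} (S : ScaledCircumcentre u v) → let open ScaledCircumcentre S in
  + 3 * ∥ centre ∥² ≤ + 7 * (+ suc n * + suc n) →
  ∥ u ∥² * ∥ v ∥² * ∥ u -ᵥ v ∥² ≤ + 7 * (cross u v * cross u v)
sides-product-bound {u} {v} S 3R²≤7 = ℤ.*-cancelˡ-≤-pos _ _ (+ 9) (begin
  + 9 * P                       ≡⟨ ℤ.*-assoc (+ 3) (+ 3) P ⟩
  + 3 * (+ 3 * P)               ≡⟨ cong (+ 3 *_) ∥centre∥² ⟨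
  + 3 * ∥ centre ∥²             ≤⟨ 3R²≤7 ⟩
  + 7 * (+ suc n * + suc n)     ≡⟨ cong (+ 7 *_) denominator² ⟩
  + 7 * (+ 9 * D²)              ≡⟨ trans (sym (ℤ.*-assoc (+ 7) (+ 9) D²)) (ℤ.*-assoc (+ 9) (+ 7) D²) ⟩
  + 9 * (+ 7 * D²)              ∎)
  where
  open ScaledCircumcentre S
  open ℤ.≤-Reasoning
  P D² : ℤ
  P = ∥ u ∥² * ∥ v ∥² * ∥ u -ᵥ v ∥²
  D² = cross u v * cross u v

∈-square3 : ∀ u → + 3 * ∥ u ∥² ≤ + 28 → u ∈ square 3
∈-square3 u 3∥u∥²≤28 = ∈-square 3 u (ℤ.*-cancelˡ-<-nonNeg (+ 3) (begin-strict
  + 3 * (+ 4 * ∥ u ∥²)      ≡⟨ trans (sym (ℤ.*-assoc (+ 3) (+ 4) ∥ u ∥²)) (ℤ.*-assoc (+ 4) (+ 3) ∥ u ∥²) ⟩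
  + 4 * (+ 3 * ∥ u ∥²)      ≤⟨ ℤ.*-monoˡ-≤-nonNeg (+ 4) 3∥u∥²≤28 ⟩
  + 112                     <⟨ +<+ (ℕ.<ᵇ⇒< 112 144 _) ⟩
  + 144                     ∎))
  where open ℤ.≤-Reasoning

SmallOrRegular : Site → Site → Set
SmallOrRegular u v =
  ∥ u ∥² * ∥ v ∥² * ∥ u -ᵥ v ∥² ≤ + 7 * (cross u v * cross u v) →
  + 3 * (cross u v * cross u v) ≤ + 108 ⊎ (∥ u ∥² ≡ + 7 × ∥ v ∥² ≡ + 7 × ∥ u -ᵥ v ∥² ≡ + 7)

small-or-regular : ∀ {u v} → u ∈ square 3 → v ∈ square 3 → SmallOrRegular u v
small-or-regular u∈ v∈ = All.lookup (All.lookup all-small-or-regular u∈) v∈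
  where
  small-or-regular? : ∀ u v → Dec (SmallOrRegular u v)
  small-or-regular? u v = (_ ℤ.≤? _) →-dec ((_ ℤ.≤? + 108) ⊎-dec
    (∥ u ∥² ℤ.≟ + 7) ×-dec (∥ v ∥² ℤ.≟ + 7) ×-dec (∥ u -ᵥ v ∥² ℤ.≟ + 7))
  all-small-or-regular : All (λ u → All (SmallOrRegular u) (square 3)) (square 3)
  all-small-or-regular = from-yes (all? (λ u → all? (small-or-regular? u) (square 3)) (square 3))

lemma6 : (ω : Config) → InX ω → (t : Triangle) → DelaunayTriangle ω t → Defective t →
    sixteenAreaSq t ≤ + 108
lemma6 ω (_ , maximal) (a , b , c) (_ , _ , _ , nondegenerate , empty) defective =
  fromInj₁ (λ regular → contradiction (regular-triangle regular) defective)
    (small-or-regular (∈-square3 u u-short) (∈-square3 v v-short) (sides-product-bound S 3R²≤7))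
  where
  u v : Site
  u = b -ᵥ a
  v = c -ᵥ a
  S : ScaledCircumcentre u v
  S = scaled-circumcentre u v nondegenerate
  open ScaledCircumcentre S
  3R²≤7 : + 3 * ∥ centre ∥² ≤ + 7 * (+ suc n * + suc n)
  3R²≤7 = delaunay-circumradius-bound maximal a b c empty S
  u-short : + 3 * ∥ u ∥² ≤ + 28
  u-short = side-bound n centre u centre∙u 3R²≤7
  v-short : + 3 * ∥ v ∥² ≤ + 28
  v-short = side-bound n centre v centre∙v 3R²≤7
  regular-triangle : ∥ u ∥² ≡ + 7 × ∥ v ∥² ≡ + 7 × ∥ u -ᵥ v ∥² ≡ + 7 → Regular (a , b , c)
  regular-triangle (u≡7 , v≡7 , u-v≡7) =
    trans (distSq-sym a b) u≡7 , trans (distSq-translate a b c) u-v≡7 , v≡7
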